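{- Let $Y=\{z_k : k\in\mathbb Z\}$ and let $\mathcal H=\langle Y\rangle_{\mathbb Q}$ be the $\mathbb Q$-vector space with basis the words in the alphabet $Y$ (including the empty word $\mathbf 1$). Let $N\subset\mathcal H$ be the $\mathbb Q$-linear span of the non-singular words. Then: (1) $N$ is a left coideal for the reduced deconcatenation coproduct, in the sense that $\widetilde\Delta(N)\subseteq N\otimes\mathcal H$; equivalently, for every non-singular word $w$ and every factorization $w=uv$ with $u,v$ nonempty words, the word $u$ is non-singular. (2) $N$ is invariant under contractions: any word obtained from a non-singular word by a contraction of a block is again non-singular.
   Context: A word $w=z_{k_1}\cdots z_{k_n}$ ($n\ge1$, $k_i\in\mathbb Z$) is called non-singular if (i) $k_1\neq 1$, (ii) $k_1+k_2\notin\{2,1,0,-2,-4,-6,\ldots\}$ (when $n\ge2$), and (iii) $k_1+\cdots+k_j\notin\mathbb Z_{\le j}$ for every $3\le j\le n$. The deconcatenation coproduct is $\Delta(w)=\sum_{uv=w}u\otimes v$ (sum over all factorizations, including those with $u$ or $v$ empty), and the reduced coproduct of a nonempty word is $\widetilde\Delta(w)=\Delta(w)-w\otimes\mathbf 1-\mathbf 1\otimes w$. A contraction of a block in a word $z_{k_1}\cdots z_{k_n}$ means replacing a block of consecutive letters $z_{k_i}z_{k_{i+1}}\cdots z_{k_m}$ ($i<m$) by the single letter $z_{k_i+\cdots+k_m}$, e.g. $z_{k_1}z_{k_2}z_{k_3}\cdots z_{k_n}\mapsto z_{k_1+k_2}z_{k_3}\cdots z_{k_n}$. -}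

module Defs where

open import Data.Nat as ℕ using (ℕ)
open import Data.Integer using (ℤ; +_; -_; _+_; _≤_)
open import Data.List using (List; []; _∷_; _++_; take; foldr; length)
open import Data.Product using (_×_; ∃-syntax)
open import Data.Sum using (_⊎_)
open import Relation.Nullary using (¬_)
open import Relation.Binary.PropositionalEquality using (_≡_; _≢_)

-- A word z_{k_1} ⋯ z_{k_n} in the alphabet Y = {z_k : k ∈ ℤ} is represented
-- by the list of its indices k_1 ∷ ⋯ ∷ k_n ∷ [] (the empty list is the empty word 𝟏).
Word : Set
Word = List ℤ

sumℤ : Word → ℤ
sumℤ = foldr _+_ (+ 0)

psum : ℕ → Word → ℤ
psum j w = sumℤ (take j w)

Excl2 : ℤ → Set
Excl2 s = s ≡ + 2 ⊎ s ≡ + 1 ⊎ ∃[ n ] s ≡ - (+ (2 ℕ.* n))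

-- non-singular words (n ≥ 1 and conditions (i), (ii), (iii))
NonSingular : Word → Set
NonSingular w =
  (1 ℕ.≤ length w)
  × (psum 1 w ≢ + 1)
  × (2 ℕ.≤ length w → ¬ Excl2 (psum 2 w))
  × (∀ j → 3 ℕ.≤ j → j ℕ.≤ length w → ¬ (psum j w ≤ + j))

contract : Word → Word → Word → Word
contract a b c = a ++ (sumℤ b ∷ c)

{-# OPTIONS --safe #-}
-- Every condition of non-singularity is a condition on the partial sums k₁ + ⋯ + kⱼ with
-- j ≤ n, and these do not change when letters are appended, which gives prefixes.
-- Contracting a block b leaves the partial sums ending before it unchanged, while the one of
-- length j ending at or after the new letter equals the partial sum of length
-- J = j + |b| − 1 > j of the original word. Condition (iii) at J (available once J ≥ 3)
-- makes it exceed J ≥ j, which implies each of (i)–(iii) at j; the only case with J < 3 is a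
-- block of length 2 at the front, where condition (i) for the contracted word is
-- condition (ii) for the original one.
module Submission where

open import Defs
open import Data.Nat as ℕ using (_≤_; _<_; zero; suc; z≤n; s≤s)
import Data.Nat.Properties as ℕ
open import Data.Integer as ℤ using (+_; _+_; +≤+; -≤+)
import Data.Integer.Properties as ℤ
open import Data.List using ([]; _∷_; _++_; length)
import Data.List.Properties as List
open import Data.Product using (_×_; _,_; ∃-syntax)
open import Data.Sum using (inj₁; inj₂)
open import Relation.Nullary using (¬_)
open import Relation.Binary.PropositionalEquality
  using (_≡_; _≢_; refl; sym; trans; cong; subst; module ≡-Reasoning)

psum-++ˡ : ∀ {j} (u v : Word) → j ≤ length u → psum j (u ++ v) ≡ psum j u
psum-++ˡ {zero}  u       v _         = refl
psum-++ˡ {suc j} (x ∷ u) v (s≤s j≤u) = cong (λ s → x + s) (psum-++ˡ u v j≤u)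

psum-++ʳ : ∀ k (u v : Word) → psum (length u ℕ.+ k) (u ++ v) ≡ sumℤ u + psum k v
psum-++ʳ k []      v = sym (ℤ.+-identityˡ (psum k v))
psum-++ʳ k (x ∷ u) v = begin
  x + psum (length u ℕ.+ k) (u ++ v) ≡⟨ cong (λ s → x + s) (psum-++ʳ k u v) ⟩
  x + (sumℤ u + psum k v)            ≡⟨ ℤ.+-assoc x (sumℤ u) (psum k v) ⟨
  (x + sumℤ u) + psum k v            ∎
  where open ≡-Reasoning

psum-contract : ∀ (a b c : Word) k →
  psum (length a ℕ.+ suc k) (contract a b c) ≡ psum (length a ℕ.+ (length b ℕ.+ k)) (a ++ b ++ c)
psum-contract a b c k = begin
  psum (length a ℕ.+ suc k) (a ++ sumℤ b ∷ c)        ≡⟨ psum-++ʳ (suc k) a (sumℤ b ∷ c) ⟩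
  sumℤ a + (sumℤ b + psum k c)                       ≡⟨ cong (λ s → sumℤ a + s) (psum-++ʳ k b c) ⟨
  sumℤ a + psum (length b ℕ.+ k) (b ++ c)            ≡⟨ psum-++ʳ (length b ℕ.+ k) a (b ++ c) ⟨
  psum (length a ℕ.+ (length b ℕ.+ k)) (a ++ b ++ c) ∎
  where open ≡-Reasoning

contract-index< : ∀ {a b : Word} k → 2 ≤ length b → length a ℕ.+ suc k < length a ℕ.+ (length b ℕ.+ k)
contract-index< {a} k 2≤b = ℕ.+-monoʳ-< (length a) (ℕ.+-monoˡ-≤ k 2≤b)

<⇒∃-+suc : ∀ {m n} → m < n → ∃[ k ] n ≡ m ℕ.+ suc k
<⇒∃-+suc {m} m<n with ℕ.m≤n⇒∃[o]m+o≡n m<n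
... | k , m+1+k≡n = k , trans (sym m+1+k≡n) (sym (ℕ.+-suc m k))

Excl2⇒≤2 : ∀ {s} → Excl2 s → s ℤ.≤ + 2
Excl2⇒≤2 (inj₁ refl)                   = ℤ.≤-refl
Excl2⇒≤2 (inj₂ (inj₁ refl))            = +≤+ (s≤s z≤n)
Excl2⇒≤2 (inj₂ (inj₂ (zero  , refl))) = +≤+ z≤n
Excl2⇒≤2 (inj₂ (inj₂ (suc n , refl))) = -≤+

NonSingular⇒psum≰ : ∀ {w J m} → NonSingular w → 3 ≤ J → J ≤ length w → m ≤ J → ¬ psum J w ℤ.≤ + m
NonSingular⇒psum≰ (_ , _ , _ , large) 3≤J J≤w m≤J ≤m = large _ 3≤J J≤w (ℤ.≤-trans ≤m (+≤+ m≤J))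

NonSingular-prefix : ∀ (u v : Word) → u ≢ [] → NonSingular (u ++ v) → NonSingular u
NonSingular-prefix []      v u≢[] _                   with () ← u≢[] refl
NonSingular-prefix (x ∷ u) v _    (_ , first , second , large) =
    s≤s z≤n
  , first
  , (λ 2≤u → subst (λ s → ¬ Excl2 s) (psum-++ˡ (x ∷ u) v 2≤u) (second (ℕ.≤-trans 2≤u u≤uv)))
  , (λ j 3≤j j≤u → subst (λ s → ¬ s ℤ.≤ + j) (psum-++ˡ (x ∷ u) v j≤u) (large j 3≤j (ℕ.≤-trans j≤u u≤uv)))
  where
  u≤uv : length (x ∷ u) ≤ length (x ∷ u ++ v)
  u≤uv = List.length-++-≤ˡ (x ∷ u)

module _ (a b c : Word) where

  contract-psum≰ : ∀ k {m} → NonSingular (a ++ b ++ c) → length a ℕ.+ suc k ≤ length (contract a b c) →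
    3 ≤ length a ℕ.+ (length b ℕ.+ k) → m ≤ length a ℕ.+ (length b ℕ.+ k) →
    ¬ psum (length a ℕ.+ suc k) (contract a b c) ℤ.≤ + m
  contract-psum≰ k ns j≤w′ 3≤J m≤J rewrite psum-contract a b c k =
    NonSingular⇒psum≰ ns 3≤J J≤w m≤J
    where
    k≤c : k ≤ length c
    k≤c = ℕ.s≤s⁻¹ (ℕ.+-cancelˡ-≤ (length a) _ _ (subst (_ ≤_) (List.length-++ a) j≤w′))
    J≤w : length a ℕ.+ (length b ℕ.+ k) ≤ length (a ++ b ++ c)
    J≤w = subst (_ ≤_) (sym (trans (List.length-++ a) (cong (length a ℕ.+_) (List.length-++ b))))
            (ℕ.+-monoʳ-≤ (length a) (ℕ.+-monoʳ-≤ (length b) k≤c))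

  contract-psum≰-after : ∀ {j} → 2 ≤ length b → NonSingular (a ++ b ++ c) →
    length a < j → 2 ≤ j → j ≤ length (contract a b c) → ¬ psum j (contract a b c) ℤ.≤ + j
  contract-psum≰-after 2≤b ns a<j 2≤j j≤w′ with <⇒∃-+suc a<j
  ... | k , refl = contract-psum≰ k ns j≤w′ (ℕ.≤-trans (s≤s 2≤j) j<J) (ℕ.<⇒≤ j<J)
    where
    j<J : length a ℕ.+ suc k < length a ℕ.+ (length b ℕ.+ k)
    j<J = contract-index< {a} {b} k 2≤b

  contract-psum-prefix : ∀ {j} → j ≤ length a → psum j (contract a b c) ≡ psum j (a ++ b ++ c)
  contract-psum-prefix j≤a = trans (psum-++ˡ a _ j≤a) (sym (psum-++ˡ a _ j≤a))

  contract-¬Excl2-psum₂ : 2 ≤ length b → NonSingular (a ++ b ++ c) →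
    2 ≤ length (contract a b c) → ¬ Excl2 (psum 2 (contract a b c))
  contract-¬Excl2-psum₂ 2≤b ns@(_ , _ , second , _) 2≤w′ excl with ℕ.≤-<-connex 2 (length a)
  ... | inj₁ 2≤a = second (ℕ.≤-trans 2≤a (List.length-++-≤ˡ a)) (subst Excl2 (contract-psum-prefix 2≤a) excl)
  ... | inj₂ a<2 = contract-psum≰-after 2≤b ns a<2 ℕ.≤-refl 2≤w′ (Excl2⇒≤2 excl)

  contract-psumⱼ≰j : 2 ≤ length b → NonSingular (a ++ b ++ c) →
    ∀ j → 3 ≤ j → j ≤ length (contract a b c) → ¬ psum j (contract a b c) ℤ.≤ + j
  contract-psumⱼ≰j 2≤b ns@(_ , _ , _ , large) j 3≤j j≤w′ with ℕ.≤-<-connex j (length a)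
  ... | inj₁ j≤a = subst (λ s → ¬ s ℤ.≤ + j) (sym (contract-psum-prefix j≤a))
                     (large j 3≤j (ℕ.≤-trans j≤a (List.length-++-≤ˡ a)))
  ... | inj₂ a<j = contract-psum≰-after 2≤b ns a<j (ℕ.≤-trans (ℕ.n≤1+n 2) 3≤j) j≤w′

contract-psum₁≢1 : ∀ (a b c : Word) → 2 ≤ length b → NonSingular (a ++ b ++ c) → psum 1 (contract a b c) ≢ + 1
contract-psum₁≢1 (x ∷ a) b c _ (_ , first , _) = first
contract-psum₁≢1 [] (_ ∷ []) c (s≤s ()) _
contract-psum₁≢1 [] (b₁ ∷ b₂ ∷ []) c _ (_ , _ , second , _) s≡1 =
  second (s≤s (s≤s z≤n)) (inj₂ (inj₁ (trans (sym (psum-contract [] (b₁ ∷ b₂ ∷ []) c 0)) s≡1)))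
contract-psum₁≢1 [] b@(_ ∷ _ ∷ _ ∷ _) c _ ns s≡1 =
  contract-psum≰ [] b c 0 ns (s≤s z≤n) (s≤s (s≤s (s≤s z≤n))) (s≤s z≤n) (ℤ.≤-reflexive s≡1)

NonSingular-contract : ∀ (a b c : Word) → 2 ≤ length b → NonSingular (a ++ b ++ c) → NonSingular (contract a b c)
NonSingular-contract a b c 2≤b ns =
    ℕ.≤-trans (s≤s z≤n) (List.length-++-≤ʳ (sumℤ b ∷ c) {a})
  , contract-psum₁≢1 a b c 2≤b ns
  , contract-¬Excl2-psum₂ a b c 2≤b ns
  , contract-psumⱼ≰j a b c 2≤b ns

mainTheorem1 :
    -- (1) left coideal: prefixes (u nonempty, v nonempty) of non-singular words are non-singular
    (∀ (u v : Word) → u ≢ [] → v ≢ [] → NonSingular (u ++ v) → NonSingular u)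
    ×
    -- (2) invariance under contraction of a block of ≥ 2 consecutive letters
    (∀ (a b c : Word) → 2 ≤ length b → NonSingular (a ++ b ++ c) → NonSingular (contract a b c))
mainTheorem1 = (λ u v u≢[] _ → NonSingular-prefix u v u≢[]) , NonSingular-contract
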